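{- Let $(\Gamma,\chi)$ be a model of $T_{pdg*}$ and let $G(x)=\sum_{i=1}^n q_i\chi^{k_i}(x)+\alpha$ be a $\chi$-function, where $n>0$, $k_1<\dots<k_n$ are integers, $q_1,\dots,q_n\in\mathbb{Q}\setminus\{0\}$ and $\alpha\in\Gamma$. Define $\mathrm{Dom}_G=\{x\in\chi(\Gamma^{<0}):x\ge\chi^{ -k_1}(c)\}$ if $k_1<0$ and $\mathrm{Dom}_G=\chi(\Gamma^{<0})$ if $k_1\ge0$. Then: (1) $G(a)=\infty$ for every $a\in\chi(\Gamma^{<0})\setminus\mathrm{Dom}_G$; (2) $G$ is injective on $\mathrm{Dom}_G$; (3) if $q_1>0$ then $G$ is strictly increasing on $\mathrm{Dom}_G$, and if $q_1<0$ then $G$ is strictly decreasing on $\mathrm{Dom}_G$.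
   Context: For an ordered abelian group $\Gamma$, $\Gamma^{<0}=\{x\in\Gamma:x<0\}$, and $a,b$ are archimedean equivalent if $|a|\le n|b|$ and $|b|\le n|a|$ for some $n\ge1$. A precontraction group is a totally ordered abelian group $\Gamma$ with a map $\chi:\Gamma\to\Gamma$ such that for all $a,b$: (1) $\chi(a)=0\iff a=0$; (2) $a\le b\Rightarrow\chi(a)\le\chi(b)$; (3) $\chi(-a)=-\chi(a)$; (4) archimedean equivalent $a,b$ of the same sign have $\chi(a)=\chi(b)$. Centripetal: $|\chi(a)|<|a|$ for $a\neq0$. $T_{pdg}$ is the theory in $L_{pdg}=\{+,-,0,<,\chi,c\}$ of nontrivial centripetal precontraction groups with: (i) $\chi(\Gamma^{<0})$ has least element $c$; (ii) $\chi$ restricts to a bijection $\chi(\Gamma^{<0})\to\chi(\Gamma^{<0})^{>c}:=\{x\in\chi(\Gamma^{<0}):x>c\}$; (iii) for $a<b$ in $\chi(\Gamma^{<0})$, $a<\chi(a)\le b$; (iv) $\Gamma$ divisible. $L_{pdg*}=L_{pdg}\cup\{\infty,\chi^{ -1},\delta_1,\delta_2,\dots\}$; models of $T_{pdg}$ are viewed as $L_{pdg*}$-structures on $\Gamma_\infty=\Gamma\cup\{\infty\}$ with $x<\infty$ for $x\in\Gamma$, $x+\infty=\infty+x=-\infty=\chi(\infty)=\infty$, $\delta_n$ division by $n$, $\chi^{ -1}$ the inverse of $\chi:\chi(\Gamma^{<0})\to\chi(\Gamma^{<0})^{>c}$ on $\chi(\Gamma^{<0})^{>c}$, $\chi^{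 -1}(0)=0$, $\chi^{ -1}(c)=\infty$, $\chi^{ -1}(a)=\infty$ otherwise; $T_{pdg*}$ is the theory of these expansions. For $x\in\chi(\Gamma^{<0})$ and $k\in\mathbb{Z}$: $\chi^0(x)=x$, $\chi^k$ is the $k$-fold iterate of $\chi$ for $k>0$, and $\chi^k=(\chi^{ -1})^{ -k}$ for $k<0$; $\infty$ is absorbing in sums, so $G$ takes values in $\Gamma_\infty$. -}

module Defs where

open import Data.Nat using (ℕ; zero; suc; NonZero)
import Data.Nat as ℕ
open import Data.Integer as ℤ using (ℤ; +_; -[1+_])
open import Data.Rational as ℚ using (ℚ)
open import Data.Fin using (Fin; zero; suc)
open import Data.Product using (Σ; _×_; ∃; _,_)
open import Data.Sum using (_⊎_)
open import Data.Empty using (⊥)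
open import Data.Unit using (⊤)
open import Relation.Nullary using (¬_)
open import Relation.Binary.PropositionalEquality using (_≡_; _≢_)
open import Relation.Binary.Structures using (IsStrictTotalOrder)
open import Relation.Binary.Definitions using (Tri; tri<; tri≈; tri>)
open import Algebra.Structures using (IsAbelianGroup)

data Ext (A : Set) : Set where
  fin : A → Ext A
  ∞   : Ext A

module Mult {A : Set} (_+_ : A → A → A) (0# : A) where
  _×ₙ_ : ℕ → A → A
  zero  ×ₙ x = 0#
  suc n ×ₙ x = x + (n ×ₙ x)

absBy : ∀ {A P Q R : Set} → A → A → Tri P Q R → A
absBy neg pos (tri< _ _ _) = neg
absBy neg pos (tri≈ _ _ _) = pos
absBy neg pos (tri> _ _ _) = pos

-- A model of T_pdg, together with its canonical L_pdg* expansion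
-- (the symbols δ_n and χ⁻¹ are part of the structure, pinned down by axioms).
record PDG : Set₁ where
  infixl 6 _+_
  infix 4 _<_ _≤_
  field
    Γ   : Set
    _+_ : Γ → Γ → Γ
    -_  : Γ → Γ
    0#  : Γ
    _<_ : Γ → Γ → Set
    χ   : Γ → Γ
    c   : Γ
    isAbelianGroup     : IsAbelianGroup _≡_ _+_ 0# -_
    isStrictTotalOrder : IsStrictTotalOrder _≡_ _<_
    +-mono-<           : ∀ {a b} d → a < b → a + d < b + d

  _≤_ : Γ → Γ → Set
  a ≤ b = (a < b) ⊎ (a ≡ b)

  open Mult _+_ 0# public

  ∣_∣ : Γ → Γ
  ∣ a ∣ = absBy (- a) a (IsStrictTotalOrder.compare isStrictTotalOrder a 0#)

  ArchEquiv : Γ → Γ → Set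
  ArchEquiv a b = ∃ λ n → (1 ℕ.≤ n) × (∣ a ∣ ≤ n ×ₙ ∣ b ∣) × (∣ b ∣ ≤ n ×ₙ ∣ a ∣)

  SameSign : Γ → Γ → Set
  SameSign a b = ((0# < a) × (0# < b)) ⊎ ((a < 0#) × (b < 0#))

  InS : Γ → Set
  InS x = ∃ λ a → (a < 0#) × (χ a ≡ x)

  field
    χ-zero   : ∀ a → (χ a ≡ 0#) → a ≡ 0#
    χ-zero'  : χ 0# ≡ 0#
    χ-mono   : ∀ {a b} → a ≤ b → χ a ≤ χ b
    χ-odd    : ∀ a → χ (- a) ≡ - χ a
    χ-arch   : ∀ a b → ArchEquiv a b → SameSign a b → χ a ≡ χ b
    centripetal : ∀ a → a ≢ 0# → ∣ χ a ∣ < ∣ a ∣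
    nontrivial : ∃ λ a → a ≢ 0#
    c-in     : InS c
    c-least  : ∀ x → InS x → c ≤ x
    χ-S      : ∀ x → InS x → InS (χ x) × (c < χ x)
    χ-S-inj  : ∀ x y → InS x → InS y → χ x ≡ χ y → x ≡ y
    χ-S-surj : ∀ y → InS y → c < y → ∃ λ x → InS x × (χ x ≡ y)
    χ-between : ∀ a b → InS a → InS b → a < b → (a < χ a) × (χ a ≤ b)
    -- (iv) divisible, witnessed by δ: δ n x is division by (suc n)
    δ        : ℕ → Γ → Γ
    δ-spec   : ∀ n x → suc n ×ₙ δ n x ≡ x
    χinv        : Γ → Ext Γ
    χinv-zero   : χinv 0# ≡ fin 0#
    χinv-c      : χinv c ≡ ∞
    χinv-χ      : ∀ x → InS x → χinv (χ x) ≡ fin x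
    χinv-other  : ∀ y → y ≢ 0# → ¬ (InS y × (c < y)) → χinv y ≡ ∞

  _+∞_ : Ext Γ → Ext Γ → Ext Γ
  fin a +∞ fin b = fin (a + b)
  fin a +∞ ∞     = ∞
  ∞     +∞ _     = ∞

  _<∞_ : Ext Γ → Ext Γ → Set
  fin a <∞ fin b = a < b
  fin a <∞ ∞     = ⊤
  ∞     <∞ _     = ⊥

  χ∞ : Ext Γ → Ext Γ
  χ∞ (fin a) = fin (χ a)
  χ∞ ∞       = ∞

  χinv∞ : Ext Γ → Ext Γ
  χinv∞ (fin a) = χinv a
  χinv∞ ∞       = ∞

  iter : ℕ → (Ext Γ → Ext Γ) → Ext Γ → Ext Γ
  iter zero    f x = x
  iter (suc n) f x = f (iter n f x)

  χ^ : ℤ → Γ → Ext Γ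
  χ^ (+ n)      x = iter n χ∞ (fin x)
  χ^ (-[1+ n ]) x = iter (suc n) χinv∞ (fin x)

  χⁿ : ℕ → Γ → Γ
  χⁿ zero    x = x
  χⁿ (suc n) x = χ (χⁿ n x)

  ℤ× : ℤ → Γ → Γ
  ℤ× (+ n)      x = n ×ₙ x
  ℤ× (-[1+ n ]) x = - (suc n ×ₙ x)

  ℚ× : ℚ → Γ → Γ
  ℚ× q x = δ (ℚ.ℚ.denominator-1 q) (ℤ× (ℚ.ℚ.numerator q) x)

  ℚ×∞ : ℚ → Ext Γ → Ext Γ
  ℚ×∞ q (fin x) = fin (ℚ× q x)
  ℚ×∞ q ∞       = ∞

  sum∞ : (n : ℕ) → (Fin n → Ext Γ) → Ext Γ
  sum∞ zero    f = fin 0#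
  sum∞ (suc n) f = f zero +∞ sum∞ n (λ i → f (suc i))

  chiFun : (n : ℕ) → (Fin n → ℚ) → (Fin n → ℤ) → Γ → Γ → Ext Γ
  chiFun n q k α x = sum∞ n (λ i → ℚ×∞ (q i) (χ^ (k i) x)) +∞ fin α

  Dom : ℤ → Γ → Set
  Dom (+ _)      x = InS x
  Dom (-[1+ m ]) x = InS x × (χⁿ (suc m) c ≤ x)

module Submission where

-- Write N for the "depth" of k₁ (0 if k₁ ≥ 0, and -k₁ otherwise).  Every a in
-- Dom_G is χᴺ(x) for some x ∈ S = χ(Γ^{<0}), and then each k_i + N = e_i ≥ 0,
-- so G(χᴺ x) = P(x) + α for the "χ-polynomial" P(x) = Σ q_i χ^{e_i}(x) with
-- e₁ < e_i for i > 1.  The heart of the proof is a leading-term estimate: for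
-- x < y in S, put X = χ^{e₁}(x); by the archimedean axiom and injectivity of χ
-- on S, any b ∈ S with χ(X) ≤ b is negligible against -X (all its integer
-- multiples stay below -X in absolute value).  Hence P(y) - P(x) is -q₁X plus
-- a negligible error, and its sign is the sign of q₁.  Outside Dom_G the
-- iterated inverse χ^{k₁} runs past c and yields ∞.

open import Defs
open import Data.Nat using (ℕ; suc)
open import Data.Integer using (ℤ)
open import Data.Rational using (ℚ; 0ℚ)
import Data.Rational as Q
open import Data.Fin using (Fin; zero)
import Data.Fin as F
import Data.Integer as Z
open import Data.Product using (_×_)
open import Relation.Nullary using (¬_)
open import Relation.Binary.PropositionalEquality using (_≡_; _≢_)

open import Data.Nat using (zero; _≤′_; ≤′-refl; ≤′-step)
import Data.Nat as ℕ
import Data.Nat.Properties as ℕP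
import Data.Integer.Properties as ZP
import Data.Rational.Properties as QP
open import Data.Product using (_,_; proj₁; proj₂; ∃)
open import Data.Sum using (_⊎_; inj₁; inj₂)
open import Data.Empty using (⊥-elim)
open import Function using (flip)
open import Relation.Binary.PropositionalEquality
  using (refl; sym; trans; cong; cong₂; subst; subst₂; module ≡-Reasoning)
open import Relation.Binary.Structures using (IsStrictTotalOrder)
open import Relation.Binary.Definitions using (tri<; tri≈; tri>)
open import Algebra.Bundles using (AbelianGroup)
open import Algebra.Structures using (IsAbelianGroup)

module OrderedAbelianGroup
  {Γ : Set} (plus : Γ → Γ → Γ) (negate : Γ → Γ) (0# : Γ) (less : Γ → Γ → Set)
  (isAbelianGroup : IsAbelianGroup _≡_ plus 0# negate)
  (isStrictTotalOrder : IsStrictTotalOrder _≡_ less)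
  (+-mono-< : ∀ {a b} d → less a b → less (plus a d) (plus b d))
  where

  infixl 6 _+_ _-_
  infix 4 _<_ _≤_

  private
    _+_ : Γ → Γ → Γ
    _+_ = plus

    -_ : Γ → Γ
    -_ = negate

    _<_ : Γ → Γ → Set
    _<_ = less

    _≤_ : Γ → Γ → Set
    a ≤ b = (a < b) ⊎ (a ≡ b)

  open Mult _+_ 0#

  abelianGroup : AbelianGroup _ _
  abelianGroup = record { isAbelianGroup = isAbelianGroup }

  open AbelianGroup abelianGroup public
    using (assoc; comm; identityˡ; identityʳ; inverseʳ; commutativeSemigroup)
  open import Algebra.Properties.AbelianGroup abelianGroup public
    using (⁻¹-involutive; ε⁻¹≈ε; ⁻¹-∙-comm; ⁻¹-anti-homo‿-; \\-leftDividesˡ; //-rightDividesˡ)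
  open import Algebra.Properties.CommutativeSemigroup commutativeSemigroup public
    using (interchange)
  open IsStrictTotalOrder isStrictTotalOrder public
    using (compare) renaming (trans to <-trans)

  _-_ : Γ → Γ → Γ
  a - b = a + (- b)

  neg-+ : ∀ a b → - (a + b) ≡ - a + - b
  neg-+ a b = sym (⁻¹-∙-comm a b)

  sub-+ : ∀ a b x y → (a + b) - (x + y) ≡ (a - x) + (b - y)
  sub-+ a b x y = trans (cong ((a + b) +_) (neg-+ x y)) (interchange a b (- x) (- y))

  <-irrefl : ∀ {a} → ¬ (a < a)
  <-irrefl = IsStrictTotalOrder.irrefl isStrictTotalOrder refl

  <-≤-trans : ∀ {a b d} → a < b → b ≤ d → a < d
  <-≤-trans p (inj₁ q) = <-trans p q
  <-≤-trans p (inj₂ refl) = p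

  ≤-<-trans : ∀ {a b d} → a ≤ b → b < d → a < d
  ≤-<-trans (inj₁ p) q = <-trans p q
  ≤-<-trans (inj₂ refl) q = q

  ≤-trans : ∀ {a b d} → a ≤ b → b ≤ d → a ≤ d
  ≤-trans (inj₁ p) q = inj₁ (<-≤-trans p q)
  ≤-trans (inj₂ refl) q = q

  <⇒≱ : ∀ {a b} → a < b → ¬ (b ≤ a)
  <⇒≱ p q = <-irrefl (<-≤-trans p q)

  <-or-≥ : ∀ a b → (a < b) ⊎ (b ≤ a)
  <-or-≥ a b with compare a b
  ... | tri< p _ _ = inj₁ p
  ... | tri≈ _ e _ = inj₂ (inj₂ (sym e))
  ... | tri> _ _ p = inj₂ (inj₁ p)

  +-monoʳ-< : ∀ {a b} d → a < b → d + a < d + b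
  +-monoʳ-< {a} {b} d p = subst₂ _<_ (comm a d) (comm b d) (+-mono-< d p)

  +-monoˡ-≤ : ∀ {a b} d → a ≤ b → a + d ≤ b + d
  +-monoˡ-≤ d (inj₁ p) = inj₁ (+-mono-< d p)
  +-monoˡ-≤ d (inj₂ refl) = inj₂ refl

  +-monoʳ-≤ : ∀ {a b} d → a ≤ b → d + a ≤ d + b
  +-monoʳ-≤ d (inj₁ p) = inj₁ (+-monoʳ-< d p)
  +-monoʳ-≤ d (inj₂ refl) = inj₂ refl

  +-mono-≤ : ∀ {a b x y} → a ≤ b → x ≤ y → a + x ≤ b + y
  +-mono-≤ {b = b} {x} p q = ≤-trans (+-monoˡ-≤ x p) (+-monoʳ-≤ b q)

  +-mono-<-≤ : ∀ {a b x y} → a < b → x ≤ y → a + x < b + y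
  +-mono-<-≤ {b = b} {x} p q = <-≤-trans (+-mono-< x p) (+-monoʳ-≤ b q)

  +-mono-≤-< : ∀ {a b x y} → a ≤ b → x < y → a + x < b + y
  +-mono-≤-< {b = b} {x} p q = ≤-<-trans (+-monoˡ-≤ x p) (+-monoʳ-< b q)

  neg-antitone-< : ∀ {a b} → a < b → - b < - a
  neg-antitone-< {a} {b} p = subst₂ _<_ (\\-leftDividesˡ a (- b)) a-cancels (+-mono-< (- a + - b) p)
    where
    a-cancels : b + (- a + - b) ≡ - a
    a-cancels = trans (cong (b +_) (comm (- a) (- b))) (\\-leftDividesˡ b (- a))

  neg-antitone-≤ : ∀ {a b} → a ≤ b → - b ≤ - a
  neg-antitone-≤ (inj₁ p) = inj₁ (neg-antitone-< p)
  neg-antitone-≤ (inj₂ refl) = inj₂ refl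

  neg-reflect-< : ∀ {a b} → - a < - b → b < a
  neg-reflect-< {a} {b} p = subst₂ _<_ (⁻¹-involutive b) (⁻¹-involutive a) (neg-antitone-< p)

  neg-positive : ∀ {a} → a < 0# → 0# < - a
  neg-positive p = subst (_< _) ε⁻¹≈ε (neg-antitone-< p)

  positive-difference : ∀ {a b} → 0# < b - a → a < b
  positive-difference {a} {b} p = subst₂ _<_ (identityˡ a) (//-rightDividesˡ a b) (+-mono-< a p)

  ×-zero : ∀ n → n ×ₙ 0# ≡ 0#
  ×-zero zero = refl
  ×-zero (suc n) = trans (cong (0# +_) (×-zero n)) (identityˡ 0#)

  ×-distrib : ∀ n a b → n ×ₙ (a + b) ≡ n ×ₙ a + n ×ₙ b
  ×-distrib zero a b = sym (identityˡ 0#)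
  ×-distrib (suc n) a b = trans (cong ((a + b) +_) (×-distrib n a b)) (interchange a b _ _)

  ×-neg : ∀ n a → n ×ₙ (- a) ≡ - (n ×ₙ a)
  ×-neg zero a = sym ε⁻¹≈ε
  ×-neg (suc n) a = trans (cong (- a +_) (×-neg n a)) (sym (neg-+ a (n ×ₙ a)))

  ×-+ : ∀ m n a → (m ℕ.+ n) ×ₙ a ≡ m ×ₙ a + n ×ₙ a
  ×-+ zero n a = sym (identityˡ _)
  ×-+ (suc m) n a = trans (cong (a +_) (×-+ m n a)) (sym (assoc a _ _))

  ×-* : ∀ m n a → (m ℕ.* n) ×ₙ a ≡ m ×ₙ (n ×ₙ a)
  ×-* zero n a = refl
  ×-* (suc m) n a = trans (×-+ n (m ℕ.* n) a) (cong (n ×ₙ a +_) (×-* m n a))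

  ×-mono-≤ : ∀ n {a b} → a ≤ b → n ×ₙ a ≤ n ×ₙ b
  ×-mono-≤ zero p = inj₂ refl
  ×-mono-≤ (suc n) p = +-mono-≤ p (×-mono-≤ n p)

  ×-nonpos : ∀ n {a} → a ≤ 0# → n ×ₙ a ≤ 0#
  ×-nonpos n {a} p = subst (n ×ₙ a ≤_) (×-zero n) (×-mono-≤ n p)

  ×-suc-≥ : ∀ n {a} → 0# ≤ a → n ×ₙ a ≤ suc n ×ₙ a
  ×-suc-≥ n {a} p = subst (_≤ suc n ×ₙ a) (identityˡ _) (+-monoˡ-≤ (n ×ₙ a) p)

  ≤-suc× : ∀ n {a} → 0# ≤ a → a ≤ suc n ×ₙ a
  ≤-suc× n {a} p = subst (_≤ suc n ×ₙ a) (identityʳ a)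
    (+-monoʳ-≤ a (subst (_≤ n ×ₙ a) (×-zero n) (×-mono-≤ n p)))

  ×-cancel-< : ∀ n {a b} → suc n ×ₙ a < suc n ×ₙ b → a < b
  ×-cancel-< n {a} {b} p with <-or-≥ a b
  ... | inj₁ a<b = a<b
  ... | inj₂ b≤a = ⊥-elim (<⇒≱ p (×-mono-≤ (suc n) b≤a))

  ×-positive⁻¹ : ∀ n {a} → 0# < n ×ₙ a → 0# < a
  ×-positive⁻¹ n {a} p with <-or-≥ 0# a
  ... | inj₁ 0<a = 0<a
  ... | inj₂ a≤0 = ⊥-elim (<⇒≱ p (×-nonpos n a≤0))

  Below : Γ → Γ → Set
  Below u z = ∀ n → n ×ₙ z < u

  Negligible : Γ → Γ → Set
  Negligible u z = Below u z × Below u (- z)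

  Below-+ : ∀ {u z w} → Below u z → Below u w → Below u (z + w)
  Below-+ {u} {z} {w} bz bw n =
    ×-cancel-< 1 (subst₂ _<_ (sym doubled) (cong (u +_) (sym (identityʳ u)))
                   (+-mono-<-≤ (bz (2 ℕ.* n)) (inj₁ (bw (2 ℕ.* n)))))
    where
    doubled : 2 ×ₙ (n ×ₙ (z + w)) ≡ (2 ℕ.* n) ×ₙ z + (2 ℕ.* n) ×ₙ w
    doubled = trans (sym (×-* 2 n (z + w))) (×-distrib (2 ℕ.* n) z w)

  Below-× : ∀ {u z} j → Below u z → Below u (j ×ₙ z)
  Below-× {u} {z} j bz n = subst (_< u) (×-* n j z) (bz (n ℕ.* j))

  Below-div : ∀ {u z w} d → 0# < u → Below u z → suc d ×ₙ w ≡ z → Below u w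
  Below-div {u} {z} {w} d 0<u bz dw≡z n with <-or-≥ (n ×ₙ w) u
  ... | inj₁ p = p
  ... | inj₂ u≤nw = ⊥-elim (<⇒≱ (bz n) (≤-trans u≤nw (subst (n ×ₙ w ≤_) rescale
                      (≤-suc× d (inj₁ (<-≤-trans 0<u u≤nw))))))
    where
    open ≡-Reasoning
    rescale : suc d ×ₙ (n ×ₙ w) ≡ n ×ₙ z
    rescale = begin
      suc d ×ₙ (n ×ₙ w)    ≡⟨ sym (×-* (suc d) n w) ⟩
      (suc d ℕ.* n) ×ₙ w   ≡⟨ cong (_×ₙ w) (ℕP.*-comm (suc d) n) ⟩
      (n ℕ.* suc d) ×ₙ w   ≡⟨ ×-* n (suc d) w ⟩
      n ×ₙ (suc d ×ₙ w)    ≡⟨ cong (n ×ₙ_) dw≡z ⟩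
      n ×ₙ z               ∎

  Negligible-0 : ∀ {u} → 0# < u → Negligible u 0#
  Negligible-0 {u} 0<u = below-0 , subst (Below u) (sym ε⁻¹≈ε) below-0
    where
    below-0 : Below u 0#
    below-0 n = subst (_< u) (sym (×-zero n)) 0<u

  Negligible-neg : ∀ {u z} → Negligible u z → Negligible u (- z)
  Negligible-neg {u} {z} (bz , b-z) = b-z , subst (Below u) (sym (⁻¹-involutive z)) bz

  Negligible-+ : ∀ {u z w} → Negligible u z → Negligible u w → Negligible u (z + w)
  Negligible-+ {u} {z} {w} (bz , b-z) (bw , b-w) =
    Below-+ bz bw , subst (Below u) (sym (neg-+ z w)) (Below-+ b-z b-w)

  Negligible-- : ∀ {u z w} → Negligible u z → Negligible u w → Negligible u (z - w)
  Negligible-- nz nw = Negligible-+ nz (Negligible-neg nw)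

  Negligible-× : ∀ {u z} j → Negligible u z → Negligible u (j ×ₙ z)
  Negligible-× {u} {z} j (bz , b-z) = Below-× j bz , subst (Below u) (×-neg j z) (Below-× j b-z)

  Negligible-div : ∀ {u z w} d → 0# < u → Negligible u z → suc d ×ₙ w ≡ z → Negligible u w
  Negligible-div {z = z} {w} d 0<u (bz , b-z) dw≡z =
    Below-div d 0<u bz dw≡z , Below-div d 0<u b-z (trans (×-neg (suc d) w) (cong -_ dw≡z))

  -- p is a positive rational multiple of u.
  Commensurate : Γ → Γ → Set
  Commensurate p u = ∃ λ d → ∃ λ N → suc d ×ₙ p ≡ suc N ×ₙ u

  commensurate-dominates : ∀ {u p E} → 0# < u → Commensurate p u → Negligible u E → 0# < p + E
  commensurate-dominates {u} {p} {E} 0<u (d , N , dp≡Nu) (_ , b-E) =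
    ×-positive⁻¹ (suc d) (subst (0# <_) (sym expand) (subst (_< suc N ×ₙ u + suc d ×ₙ E) (inverseʳ u) bound))
    where
    expand : suc d ×ₙ (p + E) ≡ suc N ×ₙ u + suc d ×ₙ E
    expand = trans (×-distrib (suc d) p E) (cong (_+ suc d ×ₙ E) dp≡Nu)
    -u<dE : - u < suc d ×ₙ E
    -u<dE = subst (- u <_) (trans (cong -_ (×-neg (suc d) E)) (⁻¹-involutive _))
                  (neg-antitone-< (b-E (suc d)))
    bound : u - u < suc N ×ₙ u + suc d ×ₙ E
    bound = +-mono-≤-< (≤-suc× N (inj₁ 0<u)) -u<dE

  monotone⇒injective : ∀ {B : Set} (R : B → B → Set) → (∀ {z} → ¬ R z z) →
    {P : Γ → Set} {f : Γ → B} →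
    (∀ a b → P a → P b → a < b → R (f a) (f b)) →
    ∀ a b → P a → P b → f a ≡ f b → a ≡ b
  monotone⇒injective R R-irrefl mono a b pa pb fa≡fb with compare a b
  ... | tri< a<b _ _ = ⊥-elim (R-irrefl (subst (R _) (sym fa≡fb) (mono a b pa pb a<b)))
  ... | tri≈ _ a≡b _ = a≡b
  ... | tri> _ _ b<a = ⊥-elim (R-irrefl (subst (R _) fa≡fb (mono b a pb pa b<a)))

numerator-positive : ∀ {q} → 0ℚ Q.< q → ∃ λ N → Q.ℚ.numerator q ≡ Z.+ suc N
numerator-positive {Q.mkℚ (Z.+ suc n) _ _} _ = n , refl
numerator-positive {Q.mkℚ (Z.+ 0) _ _} 0<q with Q.positive 0<q
... | ()
numerator-positive {Q.mkℚ Z.-[1+ n ] _ _} 0<q with Q.positive 0<q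
... | ()

numerator-negative : ∀ {q} → q Q.< 0ℚ → ∃ λ N → Q.ℚ.numerator q ≡ Z.-[1+ N ]
numerator-negative {Q.mkℚ Z.-[1+ n ] _ _} _ = n , refl
numerator-negative {Q.mkℚ (Z.+ 0) _ _} q<0 with Q.negative q<0
... | ()
numerator-negative {Q.mkℚ (Z.+ suc n) _ _} q<0 with Q.negative q<0
... | ()

module Contraction (M : PDG) where
  open PDG M
  open OrderedAbelianGroup _+_ -_ 0# _<_ isAbelianGroup isStrictTotalOrder +-mono-<

  Negligible-ℤ× : ∀ {u z} j → Negligible u z → Negligible u (ℤ× j z)
  Negligible-ℤ× (Z.+ n) nz = Negligible-× n nz
  Negligible-ℤ× Z.-[1+ n ] nz = Negligible-neg (Negligible-× (suc n) nz)

  Negligible-ℚ× : ∀ {u z} q → 0# < u → Negligible u z → Negligible u (ℚ× q z)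
  Negligible-ℚ× q 0<u nz =
    Negligible-div (Q.ℚ.denominator-1 q) 0<u (Negligible-ℤ× (Q.ℚ.numerator q) nz) (δ-spec _ _)

  ℚ×-commensurate⁺ : ∀ {q} x → 0ℚ Q.< q → Commensurate (- ℚ× q x) (- x)
  ℚ×-commensurate⁺ {q} x 0<q with numerator-positive 0<q
  ... | N , num≡ = d , N , (begin
      suc d ×ₙ (- ℚ× q x)          ≡⟨ ×-neg (suc d) _ ⟩
      - (suc d ×ₙ ℚ× q x)          ≡⟨ cong -_ (δ-spec d _) ⟩
      - ℤ× (Q.ℚ.numerator q) x     ≡⟨ cong (λ z → - ℤ× z x) num≡ ⟩
      - (suc N ×ₙ x)               ≡⟨ sym (×-neg (suc N) x) ⟩
      suc N ×ₙ (- x)               ∎)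
    where
    open ≡-Reasoning
    d = Q.ℚ.denominator-1 q

  ℚ×-commensurate⁻ : ∀ {q} x → q Q.< 0ℚ → Commensurate (ℚ× q x) (- x)
  ℚ×-commensurate⁻ {q} x q<0 with numerator-negative q<0
  ... | N , num≡ = d , N , (begin
      suc d ×ₙ ℚ× q x              ≡⟨ δ-spec d _ ⟩
      ℤ× (Q.ℚ.numerator q) x       ≡⟨ cong (λ z → ℤ× z x) num≡ ⟩
      - (suc N ×ₙ x)               ≡⟨ sym (×-neg (suc N) x) ⟩
      suc N ×ₙ (- x)               ∎)
    where
    open ≡-Reasoning
    d = Q.ℚ.denominator-1 q

  ∣-∣-negative : ∀ {a} → a < 0# → ∣ a ∣ ≡ - a
  ∣-∣-negative {a} a<0 with compare a 0#
  ... | tri< _ _ _ = refl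
  ... | tri≈ _ refl _ = ⊥-elim (<-irrefl a<0)
  ... | tri> _ _ 0<a = ⊥-elim (<-irrefl (<-trans a<0 0<a))

  S-negative : ∀ {z} → InS z → z < 0#
  S-negative (a , a<0 , refl) with χ-mono (inj₁ a<0)
  ... | inj₁ χa<χ0 = subst (χ a <_) χ-zero' χa<χ0
  ... | inj₂ χa≡χ0 = ⊥-elim (<-irrefl (subst (_< 0#) (χ-zero a (trans χa≡χ0 χ-zero')) a<0))

  InS-χ : ∀ {z} → InS z → InS (χ z)
  InS-χ {z} pz = proj₁ (χ-S z pz)

  χ-centripetal : ∀ {a} → InS a → - χ a < - a
  χ-centripetal {a} pa = subst₂ _<_ (∣-∣-negative (S-negative (InS-χ pa))) (∣-∣-negative a<0)
                                  (centripetal a (λ { refl → <-irrefl a<0 }))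
    where
    a<0 = S-negative pa

  χ-inflationary : ∀ {a} → InS a → a < χ a
  χ-inflationary pa = neg-reflect-< (χ-centripetal pa)

  χ-reflect-< : ∀ {a b} → χ a < χ b → a < b
  χ-reflect-< {a} {b} χa<χb with <-or-≥ a b
  ... | inj₁ a<b = a<b
  ... | inj₂ b≤a = ⊥-elim (<⇒≱ χa<χb (χ-mono b≤a))

  χ-S-strict : ∀ {a b} → InS a → InS b → a < b → χ a < χ b
  χ-S-strict {a} {b} pa pb a<b with χ-mono (inj₁ a<b)
  ... | inj₁ χa<χb = χa<χb
  ... | inj₂ χa≡χb = ⊥-elim (<-irrefl (subst (a <_) (sym (χ-S-inj a b pa pb χa≡χb)) a<b))

  χ-S-reflect-≤ : ∀ {a b} → InS a → InS b → χ a ≤ χ b → a ≤ b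
  χ-S-reflect-≤ {a} {b} pa pb χa≤χb with <-or-≥ b a
  ... | inj₁ b<a = ⊥-elim (<⇒≱ (χ-S-strict pb pa b<a) χa≤χb)
  ... | inj₂ a≤b = a≤b

  -- Otherwise χ a and a would be archimedean equivalent, hence χ(χ a) = χ a,
  -- hence χ a = a by injectivity on S, contradicting χ a > a.
  χ-gap : ∀ {a} → InS a → ∀ n → n ×ₙ (- χ a) < - a
  χ-gap {a} pa n with <-or-≥ (n ×ₙ (- χ a)) (- a)
  ... | inj₁ below = below
  ... | inj₂ -a≤n|χa| = ⊥-elim (<-irrefl (subst (a <_) χa≡a (χ-inflationary pa)))
    where
    a<0 = S-negative pa
    χa<0 = S-negative (InS-χ pa)
    equivalent : ArchEquiv (χ a) a
    equivalent = suc n , ℕ.s≤s ℕ.z≤n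
      , subst₂ _≤_ (sym (∣-∣-negative χa<0)) (cong (suc n ×ₙ_) (sym (∣-∣-negative a<0)))
          (inj₁ (<-≤-trans (χ-centripetal pa) (≤-suc× n (inj₁ (neg-positive a<0)))))
      , subst₂ _≤_ (sym (∣-∣-negative a<0)) (cong (suc n ×ₙ_) (sym (∣-∣-negative χa<0)))
          (≤-trans -a≤n|χa| (×-suc-≥ n (inj₁ (neg-positive χa<0))))
    χa≡a : χ a ≡ a
    χa≡a = χ-S-inj (χ a) a (InS-χ pa) pa (χ-arch (χ a) a equivalent (inj₂ (χa<0 , a<0)))

  S-negligible : ∀ {a b} → InS a → InS b → χ a ≤ b → Negligible (- a) b
  S-negligible {a} {b} pa pb χa≤b =
      (λ n → ≤-<-trans (×-nonpos n (inj₁ (S-negative pb))) (neg-positive (S-negative pa)))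
    , (λ n → ≤-<-trans (×-mono-≤ n (neg-antitone-≤ χa≤b)) (χ-gap pa n))

  InS-χⁿ : ∀ n {z} → InS z → InS (χⁿ n z)
  InS-χⁿ zero pz = pz
  InS-χⁿ (suc n) pz = InS-χ (InS-χⁿ n pz)

  χⁿ-χ : ∀ n z → χⁿ n (χ z) ≡ χ (χⁿ n z)
  χⁿ-χ zero z = refl
  χⁿ-χ (suc n) z = cong χ (χⁿ-χ n z)

  χⁿ-+ : ∀ m n z → χⁿ m (χⁿ n z) ≡ χⁿ (m ℕ.+ n) z
  χⁿ-+ zero n z = refl
  χⁿ-+ (suc m) n z = cong χ (χⁿ-+ m n z)

  χⁿ-mono : ∀ n {a b} → a ≤ b → χⁿ n a ≤ χⁿ n b
  χⁿ-mono zero a≤b = a≤b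
  χⁿ-mono (suc n) a≤b = χ-mono (χⁿ-mono n a≤b)

  χⁿ-reflect-< : ∀ n {a b} → χⁿ n a < χⁿ n b → a < b
  χⁿ-reflect-< n {a} {b} lt with <-or-≥ a b
  ... | inj₁ a<b = a<b
  ... | inj₂ b≤a = ⊥-elim (<⇒≱ lt (χⁿ-mono n b≤a))

  χⁿ-increasing : ∀ {m n z} → InS z → m ≤′ n → χⁿ m z ≤ χⁿ n z
  χⁿ-increasing pz ≤′-refl = inj₂ refl
  χⁿ-increasing {n = suc n} pz (≤′-step m≤n) =
    ≤-trans (χⁿ-increasing pz m≤n) (inj₁ (χ-inflationary (InS-χⁿ n pz)))

  χⁿ-preimage : ∀ t {x} → InS x → χⁿ t c ≤ x → ∃ λ x₀ → InS x₀ × (χⁿ t x₀ ≡ x)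
  χⁿ-preimage zero {x} px _ = x , px , refl
  χⁿ-preimage (suc t) {x} px χᵗ⁺¹c≤x
    with χ-S-surj x px (<-≤-trans (proj₂ (χ-S _ (InS-χⁿ t c-in))) χᵗ⁺¹c≤x)
  ... | x' , px' , refl with χⁿ-preimage t px' (χ-S-reflect-≤ (InS-χⁿ t c-in) px' χᵗ⁺¹c≤x)
  ...   | x₀ , px₀ , χᵗx₀≡x' = x₀ , px₀ , cong χ χᵗx₀≡x'

  iter-peel : ∀ t (f : Ext Γ → Ext Γ) x → iter (suc t) f x ≡ iter t f (f x)
  iter-peel zero f x = refl
  iter-peel (suc t) f x = cong f (iter-peel t f x)

  iter-χ∞ : ∀ n x → iter n χ∞ (fin x) ≡ fin (χⁿ n x)
  iter-χ∞ zero x = refl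
  iter-χ∞ (suc n) x = cong χ∞ (iter-χ∞ n x)

  iter-χinv∞-∞ : ∀ t → iter t χinv∞ ∞ ≡ ∞
  iter-χinv∞-∞ zero = refl
  iter-χinv∞-∞ (suc t) = cong χinv∞ (iter-χinv∞-∞ t)

  χinv-undoes : ∀ t e {x} → InS x → iter t χinv∞ (fin (χⁿ (t ℕ.+ e) x)) ≡ fin (χⁿ e x)
  χinv-undoes zero e px = refl
  χinv-undoes (suc t) e px = trans (iter-peel t χinv∞ _)
    (trans (cong (iter t χinv∞) (χinv-χ _ (InS-χⁿ (t ℕ.+ e) px))) (χinv-undoes t e px))

  -- χ⁻ᵗ(a) = ∞ for a ∈ S below χᵗ(c): the inverse iterates reach c, then ∞.
  χinv-below : ∀ t {a} → InS a → a < χⁿ t c → iter t χinv∞ (fin a) ≡ ∞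
  χinv-below zero pa a<c = ⊥-elim (<⇒≱ a<c (c-least _ pa))
  χinv-below (suc t) {a} pa a<χᵗ⁺¹c with c-least a pa
  ... | inj₂ refl =
    trans (iter-peel t χinv∞ (fin c)) (trans (cong (iter t χinv∞) χinv-c) (iter-χinv∞-∞ t))
  ... | inj₁ c<a with χ-S-surj a pa c<a
  ...   | a' , pa' , refl = trans (iter-peel t χinv∞ (fin (χ a')))
          (trans (cong (iter t χinv∞) (χinv-χ a' pa')) (χinv-below t pa' (χ-reflect-< a<χᵗ⁺¹c)))

  χ^-shift : ∀ k {N e x} → InS x → k Z.+ Z.+ N ≡ Z.+ e → χ^ k (χⁿ N x) ≡ fin (χⁿ e x)
  χ^-shift (Z.+ b) {N} {e} {x} _ k+N≡e =
    trans (iter-χ∞ b _) (cong fin (trans (χⁿ-+ b N x) (cong (λ n → χⁿ n x) (ZP.+-injective k+N≡e))))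
  χ^-shift Z.-[1+ j ] {N} {e} {x} px k+N≡e =
    subst (λ n → iter (suc j) χinv∞ (fin (χⁿ n x)) ≡ fin (χⁿ e x)) (sym N≡) (χinv-undoes (suc j) e px)
    where
    open ≡-Reasoning
    N≡ : N ≡ suc j ℕ.+ e
    N≡ = ZP.+-injective (begin
      Z.+ N                                 ≡⟨ cong (Z._+ Z.+ N) (sym (ZP.+-inverseʳ (Z.+ suc j))) ⟩
      (Z.+ suc j Z.+ Z.-[1+ j ]) Z.+ Z.+ N  ≡⟨ ZP.+-assoc (Z.+ suc j) Z.-[1+ j ] (Z.+ N) ⟩
      Z.+ suc j Z.+ (Z.-[1+ j ] Z.+ Z.+ N)  ≡⟨ cong (Z._+_ (Z.+ suc j)) k+N≡e ⟩
      Z.+ (suc j ℕ.+ e)                     ∎)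

  χ^-outside : ∀ k {a} → InS a → ¬ Dom k a → χ^ k a ≡ ∞
  χ^-outside (Z.+ _) pa a∉Dom = ⊥-elim (a∉Dom pa)
  χ^-outside Z.-[1+ j ] {a} pa a∉Dom with <-or-≥ a (χⁿ (suc j) c)
  ... | inj₁ below = χinv-below (suc j) pa below
  ... | inj₂ above = ⊥-elim (a∉Dom (pa , above))

  depth : ℤ → ℕ
  depth (Z.+ _) = 0
  depth Z.-[1+ j ] = suc j

  depth-compensates : ∀ k → Z.0ℤ Z.≤ k Z.+ Z.+ depth k
  depth-compensates (Z.+ b) = Z.+≤+ ℕ.z≤n
  depth-compensates Z.-[1+ j ] = ZP.≤-reflexive (sym (ZP.n⊖n≡0 (suc j)))

  Dom-representation : ∀ k {a} → Dom k a → ∃ λ x → InS x × (χⁿ (depth k) x ≡ a)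
  Dom-representation (Z.+ _) {a} pa = a , pa , refl
  Dom-representation Z.-[1+ j ] (pa , above) = χⁿ-preimage (suc j) pa above

  sumΓ : (n : ℕ) → (Fin n → Γ) → Γ
  sumΓ zero g = 0#
  sumΓ (suc n) g = g zero + sumΓ n (λ i → g (F.suc i))

  sum∞-fin : ∀ n {f : Fin n → Ext Γ} (g : Fin n → Γ) →
    (∀ i → f i ≡ fin (g i)) → sum∞ n f ≡ fin (sumΓ n g)
  sum∞-fin zero g _ = refl
  sum∞-fin (suc n) g f≡g =
    cong₂ _+∞_ (f≡g zero) (sum∞-fin n (λ i → g (F.suc i)) (λ i → f≡g (F.suc i)))

  Negligible-sum : ∀ {u} → 0# < u → ∀ n (g h : Fin n → Γ) →
    (∀ i → Negligible u (g i - h i)) → Negligible u (sumΓ n g - sumΓ n h)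
  Negligible-sum {u} 0<u zero g h _ = subst (Negligible u) (sym (inverseʳ 0#)) (Negligible-0 0<u)
  Negligible-sum {u} 0<u (suc n) g h negl = subst (Negligible u) (sym (sub-+ _ _ _ _))
    (Negligible-+ (negl zero)
      (Negligible-sum 0<u n (λ i → g (F.suc i)) (λ i → h (F.suc i)) (λ i → negl (F.suc i))))

  chiPoly : (n : ℕ) → (Fin n → ℚ) → (Fin n → ℕ) → Γ → Γ
  chiPoly n q e x = sumΓ n (λ i → ℚ× (q i) (χⁿ (e i) x))

  module LeadingTerm (m : ℕ) (q : Fin (suc m) → ℚ) (e : Fin (suc m) → ℕ)
                     (e-lead : ∀ i → e zero ℕ.< e (F.suc i))
                     {x y : Γ} (px : InS x) (py : InS y) (x<y : x < y) where

    term : Γ → Fin (suc m) → Γ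
    term z i = ℚ× (q i) (χⁿ (e i) z)

    X : Γ
    X = χⁿ (e zero) x

    pX : InS X
    pX = InS-χⁿ (e zero) px

    0<-X : 0# < - X
    0<-X = neg-positive (S-negative pX)

    χX≤y-lead : χ X ≤ χⁿ (e zero) y
    χX≤y-lead = subst (_≤ χⁿ (e zero) y) (χⁿ-χ (e zero) x)
                      (χⁿ-mono (e zero) (proj₂ (χ-between x y px py x<y)))

    χX≤x-tail : ∀ i → χ X ≤ χⁿ (e (F.suc i)) x
    χX≤x-tail i = χⁿ-increasing px (ℕP.≤⇒≤′ (e-lead i))

    χX≤y-tail : ∀ i → χ X ≤ χⁿ (e (F.suc i)) y
    χX≤y-tail i = ≤-trans (χX≤x-tail i) (χⁿ-mono (e (F.suc i)) (inj₁ x<y))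

    tail : Γ → Γ
    tail z = sumΓ m (λ i → term z (F.suc i))

    -- P(y) - P(x) = -q₁X + E, where E collects the negligible terms.
    E : Γ
    E = term y zero + (tail y - tail x)

    E-negligible : Negligible (- X) E
    E-negligible = Negligible-+
      (Negligible-ℚ× (q zero) 0<-X (S-negligible pX (InS-χⁿ (e zero) py) χX≤y-lead))
      (Negligible-sum 0<-X m (λ i → term y (F.suc i)) (λ i → term x (F.suc i)) λ i → Negligible--
        (Negligible-ℚ× (q (F.suc i)) 0<-X (S-negligible pX (InS-χⁿ (e (F.suc i)) py) (χX≤y-tail i)))
        (Negligible-ℚ× (q (F.suc i)) 0<-X (S-negligible pX (InS-χⁿ (e (F.suc i)) px) (χX≤x-tail i))))

    difference : chiPoly (suc m) q e y - chiPoly (suc m) q e x ≡ - term x zero + E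
    difference = trans (sub-+ (term y zero) (tail y) (term x zero) (tail x))
      (trans (cong (_+ (tail y - tail x)) (comm (term y zero) (- term x zero)))
             (assoc (- term x zero) (term y zero) (tail y - tail x)))

    increasing : 0ℚ Q.< q zero → chiPoly (suc m) q e x < chiPoly (suc m) q e y
    increasing 0<q = positive-difference (subst (0# <_) (sym difference)
      (commensurate-dominates 0<-X (ℚ×-commensurate⁺ X 0<q) E-negligible))

    decreasing : q zero Q.< 0ℚ → chiPoly (suc m) q e y < chiPoly (suc m) q e x
    decreasing q<0 = positive-difference (subst (0# <_) flipped
      (commensurate-dominates 0<-X (ℚ×-commensurate⁻ X q<0) (Negligible-neg E-negligible)))
      where
      open ≡-Reasoning
      flipped : term x zero - E ≡ chiPoly (suc m) q e x - chiPoly (suc m) q e y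
      flipped = begin
        term x zero - E                  ≡⟨ cong (_- E) (sym (⁻¹-involutive _)) ⟩
        - (- term x zero) - E            ≡⟨ sym (neg-+ (- term x zero) E) ⟩
        - (- term x zero + E)            ≡⟨ cong -_ (sym difference) ⟩
        - (chiPoly (suc m) q e y - chiPoly (suc m) q e x)
                                         ≡⟨ ⁻¹-anti-homo‿- _ _ ⟩
        chiPoly (suc m) q e x - chiPoly (suc m) q e y ∎

  <∞-irrefl : ∀ {z} → ¬ (z <∞ z)
  <∞-irrefl {fin z} = <-irrefl
  <∞-irrefl {∞} ()

  module ChiFunction (m : ℕ) (q : Fin (suc m) → ℚ) (k : Fin (suc m) → ℤ) (α : Γ)
                     (k-increasing : ∀ i j → i F.< j → k i Z.< k j) where

    G : Γ → Ext Γ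
    G = chiFun (suc m) q k α

    N : ℕ
    N = depth (k zero)

    exponent : Fin (suc m) → ℕ
    exponent i = Z.∣ k i Z.+ Z.+ N ∣

    k₁-least : ∀ i → k zero Z.≤ k i
    k₁-least zero = ZP.≤-refl
    k₁-least (F.suc i) = ZP.<⇒≤ (k-increasing zero (F.suc i) (ℕ.s≤s ℕ.z≤n))

    exponent-spec : ∀ i → k i Z.+ Z.+ N ≡ Z.+ exponent i
    exponent-spec i = sym (ZP.0≤i⇒+∣i∣≡i
      (ZP.≤-trans (depth-compensates (k zero)) (ZP.+-monoˡ-≤ (Z.+ N) (k₁-least i))))

    exponent-lead : ∀ i → exponent zero ℕ.< exponent (F.suc i)
    exponent-lead i = ZP.drop‿+<+ (subst₂ Z._<_ (exponent-spec zero) (exponent-spec (F.suc i))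
      (ZP.+-monoˡ-< (Z.+ N) (k-increasing zero (F.suc i) (ℕ.s≤s ℕ.z≤n))))

    G-on-Dom : ∀ {x} → InS x → G (χⁿ N x) ≡ fin (chiPoly (suc m) q exponent x + α)
    G-on-Dom px = cong (_+∞ fin α)
      (sum∞-fin (suc m) _ (λ i → cong (ℚ×∞ (q i)) (χ^-shift (k i) px (exponent-spec i))))

    outside : ∀ a → InS a → ¬ Dom (k zero) a → G a ≡ ∞
    outside a pa a∉Dom =
      cong (λ t → (ℚ×∞ (q zero) t +∞ sum∞ m (λ i → ℚ×∞ (q (F.suc i)) (χ^ (k (F.suc i)) a))) +∞ fin α)
           (χ^-outside (k zero) pa a∉Dom)

    monotone : ∀ a b → Dom (k zero) a → Dom (k zero) b → a < b →
               (0ℚ Q.< q zero → G a <∞ G b) × (q zero Q.< 0ℚ → G b <∞ G a)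
    monotone a b da db a<b with Dom-representation (k zero) da | Dom-representation (k zero) db
    ... | x , px , refl | y , py , refl =
        (λ 0<q → subst₂ _<∞_ (sym (G-on-Dom px)) (sym (G-on-Dom py)) (+-mono-< α (increasing 0<q)))
      , (λ q<0 → subst₂ _<∞_ (sym (G-on-Dom py)) (sym (G-on-Dom px)) (+-mono-< α (decreasing q<0)))
      where open LeadingTerm m q exponent exponent-lead px py (χⁿ-reflect-< N a<b)

    increasing : 0ℚ Q.< q zero → ∀ a b → Dom (k zero) a → Dom (k zero) b → a < b → G a <∞ G b
    increasing 0<q a b da db a<b = proj₁ (monotone a b da db a<b) 0<q

    decreasing : q zero Q.< 0ℚ → ∀ a b → Dom (k zero) a → Dom (k zero) b → a < b → G b <∞ G a
    decreasing q<0 a b da db a<b = proj₂ (monotone a b da db a<b) q<0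

    injective : q zero ≢ 0ℚ → ∀ a b → Dom (k zero) a → Dom (k zero) b → G a ≡ G b → a ≡ b
    injective q₁≢0 with QP.<-cmp (q zero) 0ℚ
    ... | tri< q<0 _ _ = monotone⇒injective (flip _<∞_) (λ {z} → <∞-irrefl {z}) {Dom (k zero)} {G} (decreasing q<0)
    ... | tri≈ _ q≡0 _ = ⊥-elim (q₁≢0 q≡0)
    ... | tri> _ _ 0<q = monotone⇒injective _<∞_ (λ {z} → <∞-irrefl {z}) {Dom (k zero)} {G} (increasing 0<q)

mainTheorem9 : (M : PDG) → let open PDG M in
    (m : ℕ) (q : Fin (suc m) → ℚ) (k : Fin (suc m) → ℤ) (α : Γ) →
    (∀ i j → i F.< j → k i Z.< k j) →
    (∀ i → q i ≢ 0ℚ) →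
    ((∀ a → InS a → ¬ Dom (k zero) a → chiFun (suc m) q k α a ≡ ∞)
    × (∀ a b → Dom (k zero) a → Dom (k zero) b →
         chiFun (suc m) q k α a ≡ chiFun (suc m) q k α b → a ≡ b)
    × (0ℚ Q.< q zero → ∀ a b → Dom (k zero) a → Dom (k zero) b → a < b →
         chiFun (suc m) q k α a <∞ chiFun (suc m) q k α b)
    × (q zero Q.< 0ℚ → ∀ a b → Dom (k zero) a → Dom (k zero) b → a < b →
         chiFun (suc m) q k α b <∞ chiFun (suc m) q k α a))
mainTheorem9 M m q k α k-increasing q≢0 =
  outside , injective (q≢0 zero) , increasing , decreasing
  where open Contraction.ChiFunction M m q k α k-increasing
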